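{- Let $\Sigma$ be a finite alphabet and let $L\subseteq\Sigma^*$ be a language in $Pol(\mathcal{C}om)(\Sigma)$. Then $N^1(L)=O(\log n)$.
   Context: $\mathcal{C}om(\Sigma)$ is the set of regular languages over $\Sigma$ whose syntactic monoid is commutative (the syntactic monoid of $L$ is $\Sigma^*/\equiv_L$ where $x\equiv_L y$ iff for all $u,v$, $uxv\in L\Leftrightarrow uyv\in L$). $Pol(\mathcal{C}om)(\Sigma)$ is the set of finite unions of languages of the form $L_0a_1L_1a_2\cdots a_kL_k$ with $k\geq 0$, $a_i\in\Sigma$ and $L_i\in\mathcal{C}om(\Sigma)$. For $L\subseteq\Sigma^*$, the language problem of length $n$: Alice receives $a_1,a_3,\dots,a_{2n-1}$, Bob receives $a_2,\dots,a_{2n}$, each $a_i\in\Sigma\cup\{\epsilon\}$ ($\epsilon$ the empty word), output $1$ iff $a_1a_2\cdots a_{2n}\in L$. $N^1(L)$ is the non-deterministic communication complexity of this problem as a function of $n$: the minimum over protocols in which both players see a common proof string $s$, such that $1$-inputs are accepted for some $s$ and $0$-inputs for no $s$, of the maximum over $1$-inputs of the minimum over accepting $s$ of $|s|$ plus the number of bits communicated. -}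

module Defs where

open import Data.Nat using (ℕ; zero; suc; _+_; _*_; _≤_)
open import Data.Nat.Logarithm using (⌈log₂_⌉)
open import Data.Fin using (Fin)
open import Data.Bool using (Bool; true; false; if_then_else_)
open import Data.Maybe using (Maybe; just; nothing)
open import Data.List using (List; []; _∷_; _++_; length; foldl)
open import Data.List.Relation.Unary.Any using (Any)
open import Data.Vec using (Vec; []; _∷_)
open import Data.Product using (Σ; ∃; ∃-syntax; _×_; _,_)
open import Function.Bundles using (_⇔_)
open import Relation.Binary.PropositionalEquality using (_≡_)

Language : Set → Set₁
Language A = List A → Set

record DFA (A : Set) : Set where
  field
    states : ℕ
    start  : Fin states
    step   : Fin states → A → Fin states
    final  : Fin states → Bool

  run : List A → Fin states
  run w = foldl step start w

  accepts : List A → Bool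
  accepts w = final (run w)

IsRegular : {A : Set} → Language A → Set
IsRegular {A} L = Σ (DFA A) λ D → ∀ w → L w ⇔ (DFA.accepts D w ≡ true)

SyntacticallyEquiv : {A : Set} → Language A → List A → List A → Set
SyntacticallyEquiv L x y = ∀ u v → L (u ++ x ++ v) ⇔ L (u ++ y ++ v)

SyntacticMonoidCommutative : {A : Set} → Language A → Set
SyntacticMonoidCommutative L = ∀ x y → SyntacticallyEquiv L (x ++ y) (y ++ x)

IsCom : {A : Set} → Language A → Set
IsCom L = IsRegular L × SyntacticMonoidCommutative L

ComLanguage : Set → Set₁
ComLanguage A = Σ (Language A) IsCom

-- A monomial  L₀ a₁ L₁ ⋯ aₖ Lₖ  is given by L₀ and the list [(a₁,L₁),…,(aₖ,Lₖ)]
record Monomial (A : Set) : Set₁ where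
  constructor mono
  field
    first : ComLanguage A
    rest  : List (A × ComLanguage A)

InProduct : {A : Set} → ComLanguage A → List (A × ComLanguage A) → Language A
InProduct (L₀ , _) [] w = L₀ w
InProduct (L₀ , _) ((a , L₁) ∷ r) w =
  ∃[ u ] ∃[ v ] (w ≡ u ++ (a ∷ v)) × L₀ u × InProduct L₁ r v

InMonomial : {A : Set} → Monomial A → Language A
InMonomial (mono L₀ r) = InProduct L₀ r

IsPolCom : {A : Set} → Language A → Set₁
IsPolCom {A} L = Σ (List (Monomial A)) λ ms →
  ∀ w → L w ⇔ Any (λ m → InMonomial m w) ms

data Protocol (X Y : Set) : Set where
  leaf  : Bool → Protocol X Y
  -- Alice sends bit f x; continue in left subtree on false, right on true
  alice : (X → Bool) → Protocol X Y → Protocol X Y → Protocol X Y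
  bob   : (Y → Bool) → Protocol X Y → Protocol X Y → Protocol X Y

module _ {X Y : Set} where
  output : Protocol X Y → X → Y → Bool
  output (leaf b)      x y = b
  output (alice f p q) x y = if f x then output q x y else output p x y
  output (bob g p q)   x y = if g y then output q x y else output p x y

  bits : Protocol X Y → X → Y → ℕ
  bits (leaf b)      x y = 0
  bits (alice f p q) x y = suc (if f x then bits q x y else bits p x y)
  bits (bob g p q)   x y = suc (if g y then bits q x y else bits p x y)

-- a₁ a₂ ⋯ a₂ₙ with Alice holding odd positions, Bob even ones;
-- nothing = ε
consε : {A : Set} → Maybe A → List A → List A
consε nothing  w = w
consε (just a) w = a ∷ w

combine : {A : Set} {n : ℕ} → Vec (Maybe A) n → Vec (Maybe A) n → List A
combine []       []       = []
combine (x ∷ xs) (y ∷ ys) = consε x (consε y (combine xs ys))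

-- A non-deterministic protocol: for every proof string s a deterministic
-- protocol; it solves the language problem of length n for L with
-- cost at most c if
--  * every 0-input is rejected for all s,
--  * every 1-input is accepted by some s with |s| + bits ≤ c.
NProtocol : Set → ℕ → Set
NProtocol A n = List Bool → Protocol (Vec (Maybe A) n) (Vec (Maybe A) n)

NSolvesWithCost : {A : Set} → Language A → (n : ℕ) → NProtocol A n → ℕ → Set
NSolvesWithCost L n P c =
  (∀ x y → L (combine x y) → ∃[ s ] (output (P s) x y ≡ true) × (length s + bits (P s) x y ≤ c))
  × (∀ x y s → output (P s) x y ≡ true → L (combine x y))

-- A Com language is closed under permuting letters, so a word w lies in it iff Alice's
-- letters followed by Bob's do. With a DFA for it, the prover names the state q reached on
-- Alice's letters; Alice checks q and Bob checks that his letters lead from q to acceptance.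
-- For L₀ a₁ L₁ ⋯ aₖ Lₖ the prover also names the positions of the aᵢ and who holds them,
-- and for a union which monomial is used: O(1) numbers below 2^O(log n), hence O(log n)
-- bits, after which each player sends one bit.

module Submission where

open import Defs
open import Data.Bool using (Bool; true; false; T; _∧_; if_then_else_)
open import Data.Bool.Properties using (T-∧; T-≡)
open import Data.Fin as Fin using (Fin; toℕ; fromℕ<)
open import Data.Fin.Properties using (toℕ<n; fromℕ<-toℕ)
open import Data.List using (List; []; _∷_; _++_; [_]; length; foldl; map; take; drop; catMaybes; concatMap)
open import Data.List.Properties
  using ( ++-assoc; ++-identityʳ; ∷-injective; foldl-++; map-++; catMaybes-++; take-map; drop-map
        ; take++drop≡id; length-++; length-++-≤ˡ; length-++-≤ʳ; length-++-sucʳ )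
open import Data.List.Relation.Binary.Permutation.Propositional using (_↭_; refl; prep; swap; trans; ↭-sym)
open import Data.List.Relation.Binary.Permutation.Propositional.Properties using (shift)
open import Data.List.Relation.Unary.All using (All; []; _∷_)
open import Data.List.Relation.Unary.Any using (Any; here; there)
open import Data.Maybe using (Maybe; just; nothing)
open import Data.Nat using (ℕ; zero; suc; _+_; _*_; _∸_; _^_; _≤_; _<_; _≡ᵇ_; z≤n; s≤s; z<s; NonZero; ⌊_/2⌋; ⌈_/2⌉)
open import Data.Nat.DivMod using (_/_; m*n/n≡m)
open import Data.Nat.Induction using (<-rec)
open import Data.Nat.Logarithm using (⌈log₂_⌉; ⌈log₂⌉-mono-≤; ⌈log₂2^n⌉≡n; ⌈log₂⌈n/2⌉⌉≡⌈log₂n⌉∸1)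
open import Data.Nat.Properties
open import Data.Nat.Solver using (module +-*-Solver)
open import Data.Product using (Σ; ∃-syntax; _×_; _,_; proj₁; proj₂)
open import Data.Product.Function.NonDependent.Propositional using (_×-⇔_)
open import Data.Vec using (Vec; []; _∷_)
open import Function.Bundles using (_⇔_; Equivalence; mk⇔)
open import Function.Construct.Composition using (_⇔-∘_)
open import Function.Construct.Identity using (⇔-id)
open import Function.Construct.Symmetry using (⇔-sym)
open import Relation.Binary.Definitions using (DecidableEquality)
open import Relation.Binary.PropositionalEquality
  using (_≡_; refl; sym; cong; cong₂; subst; subst₂; module ≡-Reasoning)
  renaming (trans to ≡-trans)
open import Relation.Nullary using (yes; no; contradiction)
open import Relation.Nullary.Decidable using (⌊_⌋; toWitness; fromWitness)

open Equivalence using (to; from)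

-- Commutative languages

module _ {A : Set} {L : Language A} where

  syntactic-trans : ∀ {x y z} → SyntacticallyEquiv L x y → SyntacticallyEquiv L y z →
                    SyntacticallyEquiv L x z
  syntactic-trans x≈y y≈z u v = y≈z u v ⇔-∘ x≈y u v

  syntactic-∷ : ∀ {x y} a → SyntacticallyEquiv L x y → SyntacticallyEquiv L (a ∷ x) (a ∷ y)
  syntactic-∷ {x} {y} a x≈y u v =
    subst₂ (λ s t → L s ⇔ L t) (++-assoc u [ a ] (x ++ v)) (++-assoc u [ a ] (y ++ v))
      (x≈y (u ++ [ a ]) v)

  syntactic-++ʳ : ∀ {x y} z → SyntacticallyEquiv L x y → SyntacticallyEquiv L (x ++ z) (y ++ z)
  syntactic-++ʳ {x} {y} z x≈y u v =
    subst₂ (λ s t → L (u ++ s) ⇔ L (u ++ t)) (sym (++-assoc x z v)) (sym (++-assoc y z v))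
      (x≈y u (z ++ v))

  ↭⇒syntacticallyEquiv : SyntacticMonoidCommutative L → ∀ {x y} → x ↭ y →
                         SyntacticallyEquiv L x y
  ↭⇒syntacticallyEquiv comm refl u v = ⇔-id _
  ↭⇒syntacticallyEquiv comm (prep a x↭y) = syntactic-∷ a (↭⇒syntacticallyEquiv comm x↭y)
  ↭⇒syntacticallyEquiv comm (swap {xs} a b x↭y) =
    syntactic-trans (syntactic-++ʳ xs (comm [ a ] [ b ]))
      (syntactic-∷ b (syntactic-∷ a (↭⇒syntacticallyEquiv comm x↭y)))
  ↭⇒syntacticallyEquiv comm (trans x↭y y↭z) =
    syntactic-trans (↭⇒syntacticallyEquiv comm x↭y) (↭⇒syntacticallyEquiv comm y↭z)

  commutative-↭ : SyntacticMonoidCommutative L → ∀ {x y} → x ↭ y → L x ⇔ L y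
  commutative-↭ comm {x} {y} x↭y =
    subst₂ (λ s t → L s ⇔ L t) (++-identityʳ x) (++-identityʳ y)
      (↭⇒syntacticallyEquiv comm x↭y [] [])

module _ {A : Set} (D : DFA A) where
  open DFA D

  acceptsFrom : Fin states → List A → Bool
  acceptsFrom s w = final (foldl step s w)

  accepts-++ : ∀ u v → accepts (u ++ v) ≡ acceptsFrom (run u) v
  accepts-++ u v = cong final (foldl-++ step start u v)

  acceptsFromIndex : ℕ → List A → Bool
  acceptsFromIndex q w with q <? states
  ... | yes q<n = acceptsFrom (fromℕ< q<n) w
  ... | no _    = false

  acceptsFromIndex-toℕ : ∀ s w → acceptsFromIndex (toℕ s) w ≡ acceptsFrom s w
  acceptsFromIndex-toℕ s w with toℕ s <? states
  ... | yes s<n = cong (λ t → acceptsFrom t w) (fromℕ<-toℕ s s<n)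
  ... | no  s≮n = contradiction (toℕ<n s) s≮n

dfa : {A : Set} → ComLanguage A → DFA A
dfa (_ , (D , _) , _) = D

take-length-++ : ∀ {X : Set} {n} (xs ys : List X) → length xs ≡ n → take n (xs ++ ys) ≡ xs
take-length-++ []       ys refl = refl
take-length-++ (x ∷ xs) ys refl = cong (x ∷_) (take-length-++ xs ys refl)

drop-length-++ : ∀ {X : Set} {n} (xs ys : List X) → length xs ≡ n → drop n (xs ++ ys) ≡ ys
drop-length-++ []       ys refl = refl
drop-length-++ (x ∷ xs) ys refl = drop-length-++ xs ys refl

drop-∷ : ∀ {X : Set} p {xs : List X} {x ys} → drop p xs ≡ x ∷ ys → drop (suc p) xs ≡ ys
drop-∷ zero          refl = refl
drop-∷ (suc p) {[]}  ()
drop-∷ (suc p) {_ ∷ xs} eq = drop-∷ p eq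

catMaybes-∷ : ∀ {X : Set} (m : Maybe X) ms → catMaybes (m ∷ ms) ≡ consε m (catMaybes ms)
catMaybes-∷ (just _) ms = refl
catMaybes-∷ nothing  ms = refl

-- Words split between two players

data Player : Set where
  alice bob : Player

playerCode : Player → ℕ
playerCode alice = 0
playerCode bob   = 1

decodePlayer : ℕ → Player
decodePlayer zero    = alice
decodePlayer (suc _) = bob

playerCode<2 : ∀ p → playerCode p < 2
playerCode<2 alice = s≤s z≤n
playerCode<2 bob   = s≤s (s≤s z≤n)

Slot : Set → Set
Slot A = Player × Maybe A

module _ {A : Set} where

  visibleTo : Player → Slot A → Maybe A
  visibleTo alice (alice , m) = m
  visibleTo bob   (bob   , m) = m
  visibleTo _     _           = nothing

  view : Player → List (Slot A) → List (Maybe A)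
  view p = map (visibleTo p)

  letters : Player → List (Slot A) → List A
  letters p zs = catMaybes (view p zs)

  word : List (Slot A) → List A
  word zs = catMaybes (map proj₂ zs)

  visibleTo-just : ∀ p s {a} → visibleTo p s ≡ just a → s ≡ (p , just a)
  visibleTo-just alice (alice , m) refl = refl
  visibleTo-just bob   (bob   , m) refl = refl
  visibleTo-just alice (bob   , m) ()
  visibleTo-just bob   (alice , m) ()

  word-↭ : ∀ zs → word zs ↭ letters alice zs ++ letters bob zs
  word-↭ []                       = refl
  word-↭ ((alice , nothing) ∷ zs) = word-↭ zs
  word-↭ ((bob   , nothing) ∷ zs) = word-↭ zs
  word-↭ ((alice , just a)  ∷ zs) = prep a (word-↭ zs)
  word-↭ ((bob   , just b)  ∷ zs) =
    trans (prep b (word-↭ zs)) (↭-sym (shift b (letters alice zs) (letters bob zs)))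

  word-++ : ∀ xs ys → word (xs ++ ys) ≡ word xs ++ word ys
  word-++ xs ys = ≡-trans (cong catMaybes (map-++ proj₂ xs ys)) (catMaybes-++ (map proj₂ xs) _)

  cut-word : ∀ p zs {o a ys} → drop p zs ≡ (o , just a) ∷ ys →
             word zs ≡ word (take p zs) ++ a ∷ word ys
  cut-word p zs {o} {a} {ys} eq = begin
    word zs                              ≡⟨ cong word (take++drop≡id p zs) ⟨
    word (take p zs ++ drop p zs)        ≡⟨ word-++ (take p zs) (drop p zs) ⟩
    word (take p zs) ++ word (drop p zs) ≡⟨ cong (λ t → word (take p zs) ++ word t) eq ⟩
    word (take p zs) ++ a ∷ word ys      ∎
    where open ≡-Reasoning

  word-split : ∀ zs {u a v} → word zs ≡ u ++ a ∷ v →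
    ∃[ pre ] ∃[ o ] ∃[ post ] zs ≡ pre ++ (o , just a) ∷ post × word pre ≡ u × word post ≡ v
  word-split [] {[]}    ()
  word-split [] {_ ∷ _} ()
  word-split ((o , nothing) ∷ zs) eq with word-split zs eq
  ... | pre , o′ , post , refl , refl , refl = (o , nothing) ∷ pre , o′ , post , refl , refl , refl
  word-split ((o , just a) ∷ zs) {[]} refl = [] , o , zs , refl , refl , refl
  word-split ((o , just c) ∷ zs) {_ ∷ u} eq with ∷-injective eq
  ... | refl , eq′ with word-split zs eq′
  ... | pre , o′ , post , refl , refl , refl = (o , just c) ∷ pre , o′ , post , refl , refl , refl

Check : Set → Set
Check A = Player → List (Maybe A) → Bool

module _ {A : Set} where

  Passes : Check A → List (Slot A) → Set
  Passes c zs = T (c alice (view alice zs)) × T (c bob (view bob zs))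

  Passes-∧ : ∀ (c d : Check A) zs →
             Passes (λ p v → c p v ∧ d p v) zs ⇔ (Passes c zs × Passes d zs)
  Passes-∧ c d zs = mk⇔
    (λ (hᵃ , hᵇ) → let (cᵃ , dᵃ) = to T-∧ hᵃ ; (cᵇ , dᵇ) = to T-∧ hᵇ in (cᵃ , cᵇ) , (dᵃ , dᵇ))
    (λ ((cᵃ , cᵇ) , (dᵃ , dᵇ)) → from T-∧ (cᵃ , dᵃ) , from T-∧ (cᵇ , dᵇ))

  Passes-natural : (φ : ∀ {X : Set} → List X → List X) →
                   (∀ {X Y : Set} (f : X → Y) xs → φ (map f xs) ≡ map f (φ xs)) →
                   ∀ (c : Check A) zs → Passes (λ p v → c p (φ v)) zs ⇔ Passes c (φ zs)
  Passes-natural φ natural c zs = mk⇔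
    (λ (hᵃ , hᵇ) → subst Tᵃ (natural _ zs) hᵃ , subst Tᵇ (natural _ zs) hᵇ)
    (λ (hᵃ , hᵇ) → subst Tᵃ (sym (natural _ zs)) hᵃ , subst Tᵇ (sym (natural _ zs)) hᵇ)
    where
    Tᵃ Tᵇ : List (Maybe A) → Set
    Tᵃ v = T (c alice v)
    Tᵇ v = T (c bob v)

-- Certificates for Pol(Com)

module _ {A : Set} (_≟_ : DecidableEquality A) where

  segmentCheck : DFA A → ℕ → Check A
  segmentCheck D q alice v = toℕ (DFA.run D (catMaybes v)) ≡ᵇ q
  segmentCheck D q bob   v = acceptsFromIndex D q (catMaybes v)

  com-split : ∀ (L₀ : ComLanguage A) zs → let D = dfa L₀ in
              proj₁ L₀ (word zs) ⇔ T (acceptsFrom D (DFA.run D (letters alice zs)) (letters bob zs))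
  com-split (L , (D , L⇔D) , comm) zs =
    subst (λ b → L (word zs) ⇔ T b) (accepts-++ D (letters alice zs) (letters bob zs))
      (⇔-sym T-≡ ⇔-∘ (L⇔D _ ⇔-∘ commutative-↭ {L = L} comm (word-↭ zs)))

  segment-sound : ∀ L₀ {q} zs → Passes (segmentCheck (dfa L₀) q) zs → proj₁ L₀ (word zs)
  segment-sound L₀@(_ , (D , _) , _) {q} zs (hᵃ , hᵇ) =
    from (com-split L₀ zs)
      (subst T (acceptsFromIndex-toℕ D _ _)
        (subst (λ i → T (acceptsFromIndex D i (letters bob zs))) (sym (≡ᵇ⇒≡ _ q hᵃ)) hᵇ))

  segment-complete : ∀ L₀ zs → proj₁ L₀ (word zs) →
    Passes (segmentCheck (dfa L₀) (toℕ (DFA.run (dfa L₀) (letters alice zs)))) zs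
  segment-complete L₀@(_ , (D , _) , _) zs h =
    ≡⇒≡ᵇ (toℕ (DFA.run D (letters alice zs))) _ refl ,
    subst T (sym (acceptsFromIndex-toℕ D _ _)) (to (com-split L₀ zs) h)

  startsWith : A → List (Maybe A) → Bool
  startsWith a (just b ∷ _) = ⌊ a ≟ b ⌋
  startsWith a _            = false

  letterCheck : Player → A → Check A
  letterCheck alice a alice v = startsWith a v
  letterCheck bob   a bob   v = startsWith a v
  letterCheck _     _ _     _ = true

  startsWith-view : ∀ p zs {a} → T (startsWith a (view p zs)) → ∃[ ys ] zs ≡ (p , just a) ∷ ys
  startsWith-view p (s ∷ ys) h with visibleTo p s in eq
  ... | just b = ys , cong (_∷ ys) (visibleTo-just p s (≡-trans eq (cong just (sym (toWitness h)))))

  letterCheck-sound : ∀ o {a} zs → Passes (letterCheck o a) zs → ∃[ ys ] zs ≡ (o , just a) ∷ ys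
  letterCheck-sound alice zs (hᵃ , _) = startsWith-view alice zs hᵃ
  letterCheck-sound bob   zs (_ , hᵇ) = startsWith-view bob zs hᵇ

  letterCheck-complete : ∀ o a ys → Passes (letterCheck (decodePlayer (playerCode o)) a) ((o , just a) ∷ ys)
  letterCheck-complete alice a ys = fromWitness refl , _
  letterCheck-complete bob   a ys = _ , fromWitness refl

  -- A certificate for L₀ a₁ L₁ ⋯ aₖ Lₖ gives, for each i, the position of aᵢ in what remains
  -- of the word, the code of the player holding it, and the state reached by the automaton of
  -- Lᵢ₋₁ on Alice's letters of the factor before aᵢ; the last entry is that state for Lₖ.
  -- A certificate for a union is prefixed by the index of the monomial.
  productCheck : ComLanguage A → List (A × ComLanguage A) → List ℕ → Check A
  productCheck L₀ [] (q ∷ []) me v = segmentCheck (dfa L₀) q me v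
  productCheck L₀ ((a , L₁) ∷ r) (p ∷ o ∷ q ∷ cs) me v =
    segmentCheck (dfa L₀) q me (take p v) ∧
    (letterCheck (decodePlayer o) a me (drop p v) ∧ productCheck L₁ r cs me (drop (suc p) v))
  productCheck _ _ _ _ _ = false

  Passes-productCheck-∷ : ∀ L₀ a L₁ r p o q cs zs →
    Passes (productCheck L₀ ((a , L₁) ∷ r) (p ∷ o ∷ q ∷ cs)) zs ⇔
    (Passes (segmentCheck (dfa L₀) q) (take p zs) ×
     Passes (letterCheck (decodePlayer o) a) (drop p zs) ×
     Passes (productCheck L₁ r cs) (drop (suc p) zs))
  Passes-productCheck-∷ L₀ a L₁ r p o q cs zs =
    (Passes-natural (take p) (λ f → take-map p) seg zs ×-⇔
     (Passes-natural (drop p) (λ f → drop-map p) letter zs ×-⇔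
      Passes-natural (drop (suc p)) (λ f → drop-map (suc p)) rest zs))
    ⇔-∘ ((⇔-id _ ×-⇔ Passes-∧ (λ me v → letter me (drop p v)) (λ me v → rest me (drop (suc p) v)) zs)
         ⇔-∘ Passes-∧ (λ me v → seg me (take p v)) (λ me v → letter me (drop p v) ∧ rest me (drop (suc p) v)) zs)
    where
    seg letter rest : Check A
    seg    = segmentCheck (dfa L₀) q
    letter = letterCheck (decodePlayer o) a
    rest   = productCheck L₁ r cs

  productCheck-sound : ∀ L₀ r cs zs → Passes (productCheck L₀ r cs) zs → InProduct L₀ r (word zs)
  productCheck-sound L₀ [] (q ∷ []) zs h = segment-sound L₀ zs h
  productCheck-sound L₀ ((a , L₁) ∷ r) (p ∷ o ∷ q ∷ cs) zs h
    with to (Passes-productCheck-∷ L₀ a L₁ r p o q cs zs) h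
  ... | seg , letter , rest with letterCheck-sound (decodePlayer o) (drop p zs) letter
  ... | ys , cut =
    word (take p zs) , word ys , cut-word p zs cut , segment-sound L₀ (take p zs) seg ,
    productCheck-sound L₁ r cs ys (subst (Passes (productCheck L₁ r cs)) (drop-∷ p cut) rest)
  productCheck-sound L₀ []      []                  zs (() , _)
  productCheck-sound L₀ []      (_ ∷ _ ∷ _)         zs (() , _)
  productCheck-sound L₀ (_ ∷ _) []                  zs (() , _)
  productCheck-sound L₀ (_ ∷ _) (_ ∷ [])            zs (() , _)
  productCheck-sound L₀ (_ ∷ _) (_ ∷ _ ∷ [])        zs (() , _)

  factorsSize : ComLanguage A → List (A × ComLanguage A) → ℕ
  factorsSize L₀ []             = DFA.states (dfa L₀)
  factorsSize L₀ ((_ , L₁) ∷ r) = suc (DFA.states (dfa L₀) + factorsSize L₁ r)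

  length≤factorsSize : ∀ L₀ r → length r ≤ factorsSize L₀ r
  length≤factorsSize L₀ []             = z≤n
  length≤factorsSize L₀ ((_ , L₁) ∷ r) = s≤s (≤-trans (length≤factorsSize L₁ r) (m≤n+m _ _))

  productCheck-cut : ∀ L₀ a L₁ r q cs pre o post →
    Passes (segmentCheck (dfa L₀) q) pre → Passes (productCheck L₁ r cs) post →
    Passes (productCheck L₀ ((a , L₁) ∷ r) (length pre ∷ playerCode o ∷ q ∷ cs))
           (pre ++ (o , just a) ∷ post)
  productCheck-cut L₀ a L₁ r q cs pre o post seg rest =
    from (Passes-productCheck-∷ L₀ a L₁ r (length pre) (playerCode o) q cs _)
      (subst (Passes (segmentCheck (dfa L₀) q)) (sym (take-length-++ pre _ refl)) seg ,
       subst (Passes (letterCheck (decodePlayer (playerCode o)) a)) (sym drop-pre)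
         (letterCheck-complete o a post) ,
       subst (Passes (productCheck L₁ r cs)) (sym (drop-∷ (length pre) drop-pre)) rest)
    where
    drop-pre : drop (length pre) (pre ++ (o , just a) ∷ post) ≡ (o , just a) ∷ post
    drop-pre = drop-length-++ pre _ refl

  productCheck-complete : ∀ {B} L₀ r zs → length zs ≤ B → factorsSize L₀ r ≤ B → 2 ≤ B →
    InProduct L₀ r (word zs) →
    ∃[ cs ] length cs ≡ suc (3 * length r) × All (_< B) cs × Passes (productCheck L₀ r cs) zs
  productCheck-complete L₀ [] zs _ size≤B _ h =
    _ ∷ [] , refl , <-≤-trans (toℕ<n _) size≤B ∷ [] , segment-complete L₀ zs h
  productCheck-complete {B} L₀ ((a , L₁) ∷ r) zs len≤B size≤B 2≤B (u , v , eq , hu , hv)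
    with word-split zs eq
  ... | pre , o , post , refl , refl , refl
    with productCheck-complete L₁ r post
           (≤-trans (n≤1+n _) (≤-trans (length-++-≤ʳ ((o , just a) ∷ post) {pre}) len≤B))
           (≤-trans (m≤n+m _ _) (<⇒≤ size≤B)) 2≤B hv
  ... | cs , length-cs , cs<B , passes =
    length pre ∷ playerCode o ∷ q ∷ cs ,
    ≡-trans (cong (3 +_) length-cs) (cong suc (sym (*-suc 3 (length r)))) ,
    pre<B ∷ <-≤-trans (playerCode<2 o) 2≤B ∷ q<B ∷ cs<B ,
    productCheck-cut L₀ a L₁ r q cs pre o post (segment-complete L₀ pre hu) passes
    where
    q : ℕ
    q = toℕ (DFA.run (dfa L₀) (letters alice pre))
    pre<B : length pre < B
    pre<B = <-≤-trans (s≤s (length-++-≤ˡ pre))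
                      (≤-trans (≤-reflexive (sym (length-++-sucʳ pre _ post))) len≤B)
    q<B : q < B
    q<B = <-≤-trans (toℕ<n _) (≤-trans (m≤m+n _ _) (<⇒≤ size≤B))

  polyCheck : List (Monomial A) → List ℕ → Check A
  polyCheck (mono L₀ r ∷ _)  (zero  ∷ cs) me v = productCheck L₀ r cs me v
  polyCheck (_         ∷ ms) (suc i ∷ cs) me v = polyCheck ms (i ∷ cs) me v
  polyCheck _                _            _  _ = false

  polySize : List (Monomial A) → ℕ
  polySize []               = 0
  polySize (mono L₀ r ∷ ms) = suc (factorsSize L₀ r + polySize ms)

  polyCheck-sound : ∀ ms cs zs → Passes (polyCheck ms cs) zs → Any (λ m → InMonomial m (word zs)) ms
  polyCheck-sound (mono L₀ r ∷ _) (zero ∷ cs)  zs h = here (productCheck-sound L₀ r cs zs h)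
  polyCheck-sound (_ ∷ ms)        (suc i ∷ cs) zs h = there (polyCheck-sound ms (i ∷ cs) zs h)
  polyCheck-sound []              _            zs (() , _)
  polyCheck-sound (_ ∷ _)         []           zs (() , _)

  polyCheck-complete : ∀ {B} ms zs → length zs ≤ B → polySize ms ≤ B → 2 ≤ B →
    Any (λ m → InMonomial m (word zs)) ms →
    ∃[ cs ] length cs ≤ 2 + 3 * polySize ms × All (_< B) cs × Passes (polyCheck ms cs) zs
  polyCheck-complete {B} ms zs len≤B size≤B 2≤B h with indexed ms size≤B h
    where
    indexed : ∀ ms → polySize ms ≤ B → Any (λ m → InMonomial m (word zs)) ms →
      ∃[ i ] ∃[ cs ] i < polySize ms × length cs ≤ suc (3 * polySize ms) × All (_< B) cs ×
        Passes (polyCheck ms (i ∷ cs)) zs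
    indexed (mono L₀ r ∷ ms) size≤B (here h)
      with productCheck-complete L₀ r zs len≤B (≤-trans (m≤m+n _ _) (<⇒≤ size≤B)) 2≤B h
    ... | cs , length-cs , cs<B , passes =
      0 , cs , z<s ,
      ≤-trans (≤-reflexive length-cs)
        (s≤s (*-monoʳ-≤ 3 (≤-trans (length≤factorsSize L₀ r) (≤-trans (m≤m+n _ _) (n≤1+n _))))) ,
      cs<B , passes
    indexed (mono L₀ r ∷ ms) size≤B (there h)
      with indexed ms (≤-trans (m≤n+m _ _) (<⇒≤ size≤B)) h
    ... | i , cs , i<size , length-cs , cs<B , passes =
      suc i , cs , s≤s (≤-trans i<size (m≤n+m _ _)) ,
      ≤-trans length-cs (s≤s (*-monoʳ-≤ 3 (≤-trans (m≤n+m (polySize ms) _) (n≤1+n _)))) ,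
      cs<B , passes
  ... | i , cs , i<size , length-cs , cs<B , passes =
    i ∷ cs , s≤s length-cs , <-≤-trans i<size size≤B ∷ cs<B , passes

module _ {A : Set} where

  interleave : ∀ {n} → Vec (Maybe A) n → Vec (Maybe A) n → List (Slot A)
  interleave []       []       = []
  interleave (x ∷ xs) (y ∷ ys) = (alice , x) ∷ (bob , y) ∷ interleave xs ys

  aliceView : ∀ {n} → Vec (Maybe A) n → List (Maybe A)
  aliceView []       = []
  aliceView (x ∷ xs) = x ∷ nothing ∷ aliceView xs

  bobView : ∀ {n} → Vec (Maybe A) n → List (Maybe A)
  bobView []       = []
  bobView (y ∷ ys) = nothing ∷ y ∷ bobView ys

  view-interleaveᵃ : ∀ {n} (x y : Vec (Maybe A) n) → view alice (interleave x y) ≡ aliceView x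
  view-interleaveᵃ []       []       = refl
  view-interleaveᵃ (x ∷ xs) (y ∷ ys) = cong (λ v → x ∷ nothing ∷ v) (view-interleaveᵃ xs ys)

  view-interleaveᵇ : ∀ {n} (x y : Vec (Maybe A) n) → view bob (interleave x y) ≡ bobView y
  view-interleaveᵇ []       []       = refl
  view-interleaveᵇ (x ∷ xs) (y ∷ ys) = cong (λ v → nothing ∷ y ∷ v) (view-interleaveᵇ xs ys)

  word-interleave : ∀ {n} (x y : Vec (Maybe A) n) → word (interleave x y) ≡ combine x y
  word-interleave []       []       = refl
  word-interleave (x ∷ xs) (y ∷ ys) =
    ≡-trans (catMaybes-∷ x (y ∷ rest))
      (cong (consε x) (≡-trans (catMaybes-∷ y rest) (cong (consε y) (word-interleave xs ys))))
    where
    rest : List (Maybe A)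
    rest = map proj₂ (interleave xs ys)

  length-interleave : ∀ {n} (x y : Vec (Maybe A) n) → length (interleave x y) ≡ n + n
  length-interleave []               []       = refl
  length-interleave {suc n} (x ∷ xs) (y ∷ ys) =
    cong suc (≡-trans (cong suc (length-interleave xs ys)) (sym (+-suc n n)))

-- Fixed-width binary encoding

fromBits : List Bool → ℕ
fromBits []       = 0
fromBits (b ∷ bs) = (if b then 2 ^ length bs else 0) + fromBits bs

toBits : ℕ → ℕ → List Bool
toBits zero    n = []
toBits (suc w) n with n <? 2 ^ w
... | yes _ = false ∷ toBits w n
... | no  _ = true  ∷ toBits w (n ∸ 2 ^ w)

length-toBits : ∀ w n → length (toBits w n) ≡ w
length-toBits zero    n = refl
length-toBits (suc w) n with n <? 2 ^ w
... | yes _ = cong suc (length-toBits w n)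
... | no  _ = cong suc (length-toBits w (n ∸ 2 ^ w))

fromBits-toBits : ∀ w n → n < 2 ^ w → fromBits (toBits w n) ≡ n
fromBits-toBits zero    zero    _         = refl
fromBits-toBits zero    (suc n) (s≤s ())
fromBits-toBits (suc w) n n<2^1+w with n <? 2 ^ w
... | yes n<2^w = fromBits-toBits w n n<2^w
... | no  n≮2^w = begin
  2 ^ length (toBits w (n ∸ 2 ^ w)) + fromBits (toBits w (n ∸ 2 ^ w))
    ≡⟨ cong₂ (λ k m → 2 ^ k + m) (length-toBits w _) (fromBits-toBits w _ rest<2^w) ⟩
  2 ^ w + (n ∸ 2 ^ w)
    ≡⟨ m+[n∸m]≡n (≮⇒≥ n≮2^w) ⟩
  n ∎
  where
  open ≡-Reasoning
  rest<2^w : n ∸ 2 ^ w < 2 ^ w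
  rest<2^w = subst (n ∸ 2 ^ w <_) (≡-trans (m+n∸m≡n (2 ^ w) _) (+-identityʳ _))
                   (∸-monoˡ-< n<2^1+w (≮⇒≥ n≮2^w))

encode : ℕ → List ℕ → List Bool
encode w = concatMap (toBits w)

decodeChunks : ℕ → ℕ → List Bool → List ℕ
decodeChunks zero    w s = []
decodeChunks (suc k) w s = fromBits (take w s) ∷ decodeChunks k w (drop w s)

decode : (w : ℕ) .{{_ : NonZero w}} → List Bool → List ℕ
decode w s = decodeChunks (length s / w) w s

length-encode : ∀ w ns → length (encode w ns) ≡ length ns * w
length-encode w []       = refl
length-encode w (n ∷ ns) =
  ≡-trans (length-++ (toBits w n)) (cong₂ _+_ (length-toBits w n) (length-encode w ns))

decodeChunks-encode : ∀ w ns → All (_< 2 ^ w) ns → decodeChunks (length ns) w (encode w ns) ≡ ns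
decodeChunks-encode w []       []            = refl
decodeChunks-encode w (n ∷ ns) (n<2^w ∷ ns<) = cong₂ _∷_
  (≡-trans (cong fromBits (take-length-++ (toBits w n) _ (length-toBits w n))) (fromBits-toBits w n n<2^w))
  (≡-trans (cong (decodeChunks (length ns) w) (drop-length-++ (toBits w n) _ (length-toBits w n)))
           (decodeChunks-encode w ns ns<))

decode-encode : ∀ w .{{_ : NonZero w}} ns → All (_< 2 ^ w) ns → decode w (encode w ns) ≡ ns
decode-encode w ns ns< =
  ≡-trans (cong (λ k → decodeChunks (k / w) w (encode w ns)) (length-encode w ns))
    (≡-trans (cong (λ k → decodeChunks k w (encode w ns)) (m*n/n≡m (length ns) w))
      (decodeChunks-encode w ns ns<))

-- Protocols

andProtocol : {X Y : Set} → (X → Bool) → (Y → Bool) → Protocol X Y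
andProtocol f g = alice f (leaf false) (bob g (leaf false) (leaf true))

output-andProtocol : ∀ {X Y : Set} (f : X → Bool) (g : Y → Bool) x y →
                     output (andProtocol f g) x y ≡ f x ∧ g y
output-andProtocol f g x y with f x | g y
... | false | _     = refl
... | true  | false = refl
... | true  | true  = refl

bits-andProtocol : ∀ {X Y : Set} (f : X → Bool) (g : Y → Bool) x y → bits (andProtocol f g) x y ≤ 2
bits-andProtocol f g x y with f x | g y
... | false | _     = s≤s z≤n
... | true  | false = ≤-refl
... | true  | true  = ≤-refl

NSolvesWithCost-mono : ∀ {A : Set} {L : Language A} {n P c c′} → c ≤ c′ →
                       NSolvesWithCost L n P c → NSolvesWithCost L n P c′
NSolvesWithCost-mono c≤c′ (accept , reject) =
  (λ x y h → let (s , out , cost) = accept x y h in s , out , ≤-trans cost c≤c′) , reject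

module _ {A : Set} (L : Language A) (n : ℕ) (check : List ℕ → Check A) (w M : ℕ) .{{_ : NonZero w}} where

  aliceAccepts bobAccepts : List Bool → Vec (Maybe A) n → Bool
  aliceAccepts s x = check (decode w s) alice (aliceView x)
  bobAccepts   s y = check (decode w s) bob (bobView y)

  certificateProtocol : NProtocol A n
  certificateProtocol s = andProtocol (aliceAccepts s) (bobAccepts s)

  certificateProtocol-accepts : ∀ s x y →
    (output (certificateProtocol s) x y ≡ true) ⇔ Passes (check (decode w s)) (interleave x y)
  certificateProtocol-accepts s x y =
    subst₂ (λ vᵃ vᵇ → (output (certificateProtocol s) x y ≡ true) ⇔ (T (c alice vᵃ) × T (c bob vᵇ)))
      (sym (view-interleaveᵃ x y)) (sym (view-interleaveᵇ x y))
      (T-∧ ⇔-∘ (⇔-sym T-≡ ⇔-∘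
        subst (λ b → (output (certificateProtocol s) x y ≡ true) ⇔ (b ≡ true))
          (output-andProtocol (aliceAccepts s) (bobAccepts s) x y) (⇔-id _)))
    where
    c : Check A
    c = check (decode w s)

  certificateProtocol-solves :
    (∀ c zs → Passes (check c) zs → L (word zs)) →
    (∀ zs → length zs ≤ n + n → L (word zs) →
       ∃[ c ] length c ≤ M × All (_< 2 ^ w) c × Passes (check c) zs) →
    NSolvesWithCost L n certificateProtocol (M * w + 2)
  certificateProtocol-solves sound complete = accept , reject
    where
    accept : ∀ x y → L (combine x y) → ∃[ s ] (output (certificateProtocol s) x y ≡ true) ×
             (length s + bits (certificateProtocol s) x y ≤ M * w + 2)
    accept x y h
      with complete (interleave x y) (≤-reflexive (length-interleave x y))
                    (subst L (sym (word-interleave x y)) h)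
    ... | c , length≤M , c<2^w , passes =
      encode w c ,
      from (certificateProtocol-accepts (encode w c) x y)
        (subst (λ c′ → Passes (check c′) (interleave x y)) (sym (decode-encode w c c<2^w)) passes) ,
      +-mono-≤ (≤-trans (≤-reflexive (length-encode w c)) (*-monoˡ-≤ w length≤M))
               (bits-andProtocol (aliceAccepts (encode w c)) (bobAccepts (encode w c)) x y)

    reject : ∀ x y s → output (certificateProtocol s) x y ≡ true → L (combine x y)
    reject x y s accepted =
      subst L (word-interleave x y)
        (sound (decode w s) (interleave x y) (to (certificateProtocol-accepts s x y) accepted))

n<2^n : ∀ n → n < 2 ^ n
n<2^n zero    = s≤s z≤n
n<2^n (suc n) = +-mono-≤-< (m^n>0 2 n) (≤-trans (n<2^n n) (m≤m+n _ 0))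

1≤⌈log₂n⌉ : ∀ {n} → 2 ≤ n → 1 ≤ ⌈log₂ n ⌉
1≤⌈log₂n⌉ {n} 2≤n = subst (_≤ ⌈log₂ n ⌉) (⌈log₂2^n⌉≡n 1) (⌈log₂⌉-mono-≤ 2≤n)

n≤2^⌈log₂n⌉ : ∀ n → n ≤ 2 ^ ⌈log₂ n ⌉
n≤2^⌈log₂n⌉ = <-rec (λ n → n ≤ 2 ^ ⌈log₂ n ⌉) bound
  where
  bound : ∀ n → (∀ {m} → m < n → m ≤ 2 ^ ⌈log₂ m ⌉) → n ≤ 2 ^ ⌈log₂ n ⌉
  bound 0 _ = z≤n
  bound 1 _ = s≤s z≤n
  bound n@(suc (suc m)) rec = begin
    n                                 ≡⟨ ⌊n/2⌋+⌈n/2⌉≡n n ⟨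
    ⌊ n /2⌋ + ⌈ n /2⌉                 ≤⟨ +-monoˡ-≤ ⌈ n /2⌉ (⌊n/2⌋≤⌈n/2⌉ n) ⟩
    ⌈ n /2⌉ + ⌈ n /2⌉                 ≤⟨ +-mono-≤ half≤ (≤-trans half≤ (m≤m+n (2 ^ (⌈log₂ n ⌉ ∸ 1)) 0)) ⟩
    2 ^ suc (⌈log₂ n ⌉ ∸ 1)           ≡⟨ cong (2 ^_) (m+[n∸m]≡n (1≤⌈log₂n⌉ {n} (s≤s (s≤s z≤n)))) ⟩
    2 ^ ⌈log₂ n ⌉                     ∎
    where
    open ≤-Reasoning
    half≤ : ⌈ n /2⌉ ≤ 2 ^ (⌈log₂ n ⌉ ∸ 1)
    half≤ = subst (λ k → ⌈ n /2⌉ ≤ 2 ^ k) (⌈log₂⌈n/2⌉⌉≡⌈log₂n⌉∸1 n) (rec (⌈n/2⌉<n m))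

affine≤linear : ∀ a b c {l} → 1 ≤ l → a * (b + l) + c ≤ (a * suc b + c) * l
affine≤linear a b c {suc l} _ = ≤-trans (m≤m+n _ ((a * b + c) * l)) (≤-reflexive identity)
  where
  open +-*-Solver
  identity : a * (b + suc l) + c + (a * b + c) * l ≡ (a * suc b + c) * suc l
  identity = solve 4 (λ a b c l → a :* (b :+ (con 1 :+ l)) :+ c :+ (a :* b :+ c) :* l
                                := (a :* (con 1 :+ b) :+ c) :* (con 1 :+ l)) refl a b c l

lemma4p8 : (k : ℕ) (L : Language (Fin k)) → IsPolCom L →
    ∃[ C ] ∃[ N₀ ] ∀ n → N₀ ≤ n →
    Σ (NProtocol (Fin k) n) λ P → NSolvesWithCost L n P (C * ⌈log₂ n ⌉)
lemma4p8 k L (ms , L⇔ms) = M * suc (suc S) + 2 , 2 , protocol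
  where
  check : List ℕ → Check (Fin k)
  check = polyCheck Fin._≟_ ms
  S M : ℕ
  S = polySize Fin._≟_ ms
  M = 2 + 3 * S

  protocol : ∀ n → 2 ≤ n → Σ (NProtocol (Fin k) n) λ P →
             NSolvesWithCost L n P ((M * suc (suc S) + 2) * ⌈log₂ n ⌉)
  protocol n 2≤n = certificateProtocol L n check w M ,
    NSolvesWithCost-mono {L = L} {P = certificateProtocol L n check w M}
      (affine≤linear M (suc S) 2 (1≤⌈log₂n⌉ 2≤n))
      (certificateProtocol-solves L n check w M
        (λ c zs h → from (L⇔ms _) (polyCheck-sound Fin._≟_ ms c zs h))
        (λ zs length≤ h → polyCheck-complete Fin._≟_ ms zs (≤-trans length≤ n+n≤2^w) S≤2^w 2≤2^w
                                               (to (L⇔ms _) h)))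
    where
    w : ℕ
    w = suc S + ⌈log₂ n ⌉
    n+n≤2^w : n + n ≤ 2 ^ w
    n+n≤2^w = ≤-trans (+-mono-≤ (n≤2^⌈log₂n⌉ n) (≤-trans (n≤2^⌈log₂n⌉ n) (m≤m+n _ 0)))
                      (^-monoʳ-≤ 2 (s≤s (m≤n+m _ S)))
    S≤2^w : S ≤ 2 ^ w
    S≤2^w = ≤-trans (<⇒≤ (n<2^n S)) (^-monoʳ-≤ 2 (≤-trans (n≤1+n S) (m≤m+n _ _)))
    2≤2^w : 2 ≤ 2 ^ w
    2≤2^w = ^-monoʳ-≤ 2 {1} {w} (s≤s z≤n)
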